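{- For every digraph $D$ of order $n$, $dac(D)\leq \frac{n+\omega(D)}{2}$.
   Context: All digraphs are finite, loopless, and simple: $D=(V,A)$ where $A$ is a set of ordered pairs $uv$ (darts) of distinct vertices; both $uv$ and $vu$ may be darts. A clique is a set of vertices such that for any two distinct $u,v$ in it both $uv$ and $vu$ are darts; $\omega(D)$ is the maximum size of a clique. A coloring of $D$ with $k$ colors is a surjective map $\varsigma:V\to\{1,\dots,k\}$; it is acyclic if each color class induces a subdigraph with no directed cycle, and complete if for every ordered pair of distinct colors $(i,j)$ there is a dart $uv$ with $\varsigma(u)=i$ and $\varsigma(v)=j$. The diachromatic number $dac(D)$ is the largest $k$ for which $D$ has a complete acyclic coloring with $k$ colors. -}

module Defs where

open import Data.Nat using (ℕ)
open import Data.Fin using (Fin)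
open import Data.Fin.Subset using (Subset; _∈_; ∣_∣)
open import Data.Product using (Σ; _×_; ∃)
open import Relation.Nullary using (¬_)
open import Relation.Binary.PropositionalEquality using (_≡_)
open import Relation.Binary.Construct.Closure.Transitive using (TransClosure)
open import Function.Definitions using (Surjective)
open import Level using (0ℓ)

record Digraph (n : ℕ) : Set₁ where
  field
    dart     : Fin n → Fin n → Set
    loopless : ∀ v → ¬ dart v v
open Digraph public

IsClique : ∀ {n} → Digraph n → Subset n → Set
IsClique {n} D C = ∀ (u v : Fin n) → u ∈ C → v ∈ C → ¬ u ≡ v → dart D u v × dart D v u

IsCliqueNumber : ∀ {n} → Digraph n → ℕ → Set
IsCliqueNumber {n} D w =
  (Σ (Subset n) λ C → IsClique D C × ∣ C ∣ ≡ w)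
  × (∀ (C : Subset n) → IsClique D C → ∣ C ∣ Data.Nat.≤ w)

DartIn : ∀ {n k} → Digraph n → (Fin n → Fin k) → Fin k → Fin n → Fin n → Set
DartIn D c i u v = dart D u v × c u ≡ i × c v ≡ i

IsColoring : ∀ {n} (k : ℕ) → (Fin n → Fin k) → Set
IsColoring k c = Surjective _≡_ _≡_ c

-- acyclic: no colour class contains a directed cycle (equivalently a
-- closed directed walk of positive length inside the class)
IsAcyclic : ∀ {n k} → Digraph n → (Fin n → Fin k) → Set
IsAcyclic {n} {k} D c = ∀ (i : Fin k) (v : Fin n) → ¬ TransClosure (DartIn D c i) v v

IsComplete : ∀ {n k} → Digraph n → (Fin n → Fin k) → Set
IsComplete {n} {k} D c =
  ∀ (i j : Fin k) → ¬ i ≡ j →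
    Σ (Fin n) λ u → Σ (Fin n) λ v → dart D u v × c u ≡ i × c v ≡ j

IsCompleteAcyclicColoring : ∀ {n} → Digraph n → (k : ℕ) → (Fin n → Fin k) → Set
IsCompleteAcyclicColoring D k c = IsColoring k c × IsAcyclic D c × IsComplete D c

{-# OPTIONS --safe #-}
-- Call a vertex lonely if it is the only vertex of its colour. By completeness
-- any two lonely vertices, having distinct colours, are joined by darts both
-- ways, so the lonely vertices form a clique and there are at most ω(D) of them.
-- Each colour is counted twice by an injection into vertices ⊎ lonely vertices:
-- once by a representative of its class, and once by a second vertex of the
-- class or, for a singleton class, by its lonely vertex.
module Submission where

open import Defs
open import Data.Nat using (ℕ; zero; suc; _+_; _*_; _≤_)
open import Data.Nat.Properties using (+-identityʳ; +-monoʳ-≤; module ≤-Reasoning)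
open import Data.Fin using (Fin; zero; suc; _≟_)
open import Data.Fin.Properties using (all?; any?; injective⇒≤; +↔⊎; suc-injective)
open import Data.Fin.Subset using (Subset; _∈_; ∣_∣)
open import Data.Vec using (_∷_; [])
open import Data.Vec.Base using (here; there)
open import Data.Bool using (true; false)
open import Data.Sum using (_⊎_; inj₁; inj₂)
open import Data.Sum.Properties using (inj₁-injective; inj₂-injective)
open import Data.Product using (_,_; proj₁; proj₂; ∃; _×_)
open import Function using (_∘_; Injective; mk↣; Injection)
open import Function.Properties.Inverse using (↔⇒↣; ↔-sym)
open import Function.Construct.Composition using (_↣-∘_)
open import Relation.Nullary using (¬_; Dec; yes; no; does; contradiction)
open import Relation.Nullary.Decidable using (_→-dec_; _×-dec_; ¬?)
open import Relation.Unary using (Pred; Decidable)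
open import Relation.Binary.PropositionalEquality
open import Level using (Level; 0ℓ)

private
  variable
    n k : ℕ
    ℓ : Level

select : {P : Pred (Fin n) ℓ} → Decidable P → Subset n
select {zero}  P? = []
select {suc n} P? = does (P? zero) ∷ select (P? ∘ suc)

∈-select⁺ : {P : Pred (Fin n) ℓ} (P? : Decidable P) {x : Fin n} → P x → x ∈ select P?
∈-select⁺ P? {zero} px with P? zero
... | yes _  = here
... | no ¬px = contradiction px ¬px
∈-select⁺ P? {suc x} px = there (∈-select⁺ (P? ∘ suc) px)

∈-select⁻ : {P : Pred (Fin n) ℓ} (P? : Decidable P) {x : Fin n} → x ∈ select P? → P x
∈-select⁻ P? {zero} x∈ with P? zero | x∈
... | yes px | here = px
∈-select⁻ P? {suc x} (there x∈) = ∈-select⁻ (P? ∘ suc) x∈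

position : (p : Subset n) {x : Fin n} → x ∈ p → Fin ∣ p ∣
position (true  ∷ p) here       = zero
position (true  ∷ p) (there x∈) = suc (position p x∈)
position (false ∷ p) (there x∈) = position p x∈

position-injective : (p : Subset n) {x y : Fin n} (x∈ : x ∈ p) (y∈ : y ∈ p) →
  position p x∈ ≡ position p y∈ → x ≡ y
position-injective (true  ∷ p) here       here       _  = refl
position-injective (true  ∷ p) (there x∈) (there y∈) eq =
  cong suc (position-injective p x∈ y∈ (suc-injective eq))
position-injective (false ∷ p) (there x∈) (there y∈) eq =
  cong suc (position-injective p x∈ y∈ eq)

⊎-injective⇒+≤ : ∀ {a b c d} {f : Fin a ⊎ Fin b → Fin c ⊎ Fin d} →
  Injective _≡_ _≡_ f → a + b ≤ c + d
⊎-injective⇒+≤ f-inj = injective⇒≤ (Injection.injective fin-injection)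
  where fin-injection = ↔⇒↣ (↔-sym +↔⊎) ↣-∘ (mk↣ f-inj ↣-∘ ↔⇒↣ +↔⊎)

Lonely : (Fin n → Fin k) → Pred (Fin n) 0ℓ
Lonely c v = ∀ u → c u ≡ c v → u ≡ v

lonely? : (c : Fin n → Fin k) → Decidable (Lonely c)
lonely? c v = all? λ u → (c u ≟ c v) →-dec (u ≟ v)

lonely : (Fin n → Fin k) → Subset n
lonely c = select (lonely? c)

module Counting (c : Fin n → Fin k) (c-surj : IsColoring k c) where

  rep : Fin k → Fin n
  rep i = proj₁ (c-surj i)

  c∘rep : ∀ i → c (rep i) ≡ i
  c∘rep i = proj₂ (c-surj i) refl

  rep-injective : Injective _≡_ _≡_ rep
  rep-injective {i} {j} eq = trans (sym (c∘rep i)) (trans (cong c eq) (c∘rep j))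

  HasPartner : Fin k → Set
  HasPartner i = ∃ λ u → c u ≡ i × u ≢ rep i

  hasPartner? : Decidable HasPartner
  hasPartner? i = any? λ u → (c u ≟ i) ×-dec ¬? (u ≟ rep i)

  rep-lonely : ∀ {i} → ¬ HasPartner i → Lonely c (rep i)
  rep-lonely {i} ¬partner u cu≡ with u ≟ rep i
  ... | yes u≡rep = u≡rep
  ... | no  u≢rep = contradiction (u , trans cu≡ (c∘rep i) , u≢rep) ¬partner

  second : ∀ i → Dec (HasPartner i) → Fin n ⊎ Fin ∣ lonely c ∣
  second i (yes (u , _)) = inj₁ u
  second i (no ¬partner) = inj₂ (position (lonely c) (∈-select⁺ (lonely? c) (rep-lonely ¬partner)))

  rep≢second : ∀ i j (p? : Dec (HasPartner j)) → inj₁ (rep i) ≢ second j p?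
  rep≢second i j (yes (u , cu≡j , u≢rep)) eq = u≢rep (begin
    u             ≡⟨ sym rep-i≡u ⟩
    rep i         ≡⟨ cong rep (trans (sym (c∘rep i)) (trans (cong c rep-i≡u) cu≡j)) ⟩
    rep j         ∎)
    where
    open ≡-Reasoning
    rep-i≡u = inj₁-injective eq
  rep≢second i j (no _) ()

  second-injective : ∀ i j (p? : Dec (HasPartner i)) (q? : Dec (HasPartner j)) →
    second i p? ≡ second j q? → i ≡ j
  second-injective i j (yes (u , cu≡i , _)) (yes (v , cv≡j , _)) eq =
    trans (sym cu≡i) (trans (cong c (inj₁-injective eq)) cv≡j)
  second-injective i j (no _) (no _) eq =
    rep-injective (position-injective (lonely c) _ _ (inj₂-injective eq))

  embed : Fin k ⊎ Fin k → Fin n ⊎ Fin ∣ lonely c ∣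
  embed (inj₁ i) = inj₁ (rep i)
  embed (inj₂ i) = second i (hasPartner? i)

  embed-injective : Injective _≡_ _≡_ embed
  embed-injective {inj₁ i} {inj₁ j} eq = cong inj₁ (rep-injective (inj₁-injective eq))
  embed-injective {inj₁ i} {inj₂ j} eq = contradiction eq (rep≢second i j (hasPartner? j))
  embed-injective {inj₂ i} {inj₁ j} eq = contradiction (sym eq) (rep≢second j i (hasPartner? i))
  embed-injective {inj₂ i} {inj₂ j} eq =
    cong inj₂ (second-injective i j (hasPartner? i) (hasPartner? j) eq)

coloring⇒k+k≤n+∣lonely∣ : (c : Fin n → Fin k) → IsColoring k c → k + k ≤ n + ∣ lonely c ∣
coloring⇒k+k≤n+∣lonely∣ c c-surj = ⊎-injective⇒+≤ (Counting.embed-injective c c-surj)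

module _ (D : Digraph n) {c : Fin n → Fin k} (complete : IsComplete D c) where

  lonely-dart : ∀ {u v} → Lonely c u → Lonely c v → c u ≢ c v → dart D u v
  lonely-dart {u} {v} u-lonely v-lonely cu≢cv with complete (c u) (c v) cu≢cv
  ... | a , b , ab , ca≡cu , cb≡cv = subst₂ (dart D) (u-lonely a ca≡cu) (v-lonely b cb≡cv) ab

  lonely-isClique : IsClique D (lonely c)
  lonely-isClique u v u∈ v∈ u≢v =
    lonely-dart u-lonely v-lonely cu≢cv , lonely-dart v-lonely u-lonely (cu≢cv ∘ sym)
    where
    u-lonely = ∈-select⁻ (lonely? c) u∈
    v-lonely = ∈-select⁻ (lonely? c) v∈
    cu≢cv : c u ≢ c v
    cu≢cv = u≢v ∘ v-lonely u

theorem4 : ∀ (n : ℕ) (D : Digraph n) (w : ℕ) → IsCliqueNumber D w →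
    ∀ (k : ℕ) (c : Fin n → Fin k) → IsCompleteAcyclicColoring D k c →
    2 * k ≤ n + w
theorem4 n D w (_ , clique-≤w) k c (c-surj , _ , complete) = begin
  2 * k              ≡⟨ cong (k +_) (+-identityʳ k) ⟩
  k + k              ≤⟨ coloring⇒k+k≤n+∣lonely∣ c c-surj ⟩
  n + ∣ lonely c ∣   ≤⟨ +-monoʳ-≤ n (clique-≤w (lonely c) (lonely-isClique D complete)) ⟩
  n + w              ∎
  where open ≤-Reasoning
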